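{- The hypotheses $\delta(G)\ge 2$ and $g(G)\ge 5$ in the inequality $\chi_{\mu_2}(G\circ H)\le\chi_{\mu_2}(G)$ cannot be relaxed: (a) there exist a graph $G$ with $\delta(G)\ge 2$ and $g(G)=4$ and a graph $H$ with $\chi_{\mu_2}(G\circ H)>\chi_{\mu_2}(G)$; (b) there exist a graph $G$ with $\delta(G)\ge 2$ and $g(G)=3$ and a graph $H$ with $\chi_{\mu_2}(G\circ H)>\chi_{\mu_2}(G)$; (c) there exist a tree $T$ (so $g(T)=\infty$ and $\delta(T)=1$) and a graph $H$ with $\chi_{\mu_2}(T\circ H)>\chi_{\mu_2}(T)$.
   Context: All graphs are finite, simple and undirected. $\delta(G)$ is the minimum degree and $g(G)$ the girth (length of a shortest cycle, $\infty$ for forests). A $u,v$-geodesic is a shortest $u,v$-path. A set $M\subseteq V(X)$ is a $2$-distance mutual-visibility set of $X$ if for every two distinct $u,v\in M$ there is a $u,v$-geodesic of length at most $2$ none of whose internal vertices lies in $M$; $\chi_{\mu_2}(X)$ is the minimum number of parts in a partition of $V(X)$ into such sets. The lexicographic product $G\circ H$ has vertex set $V(G)\times V(H)$, with $(g,h)$ and $(g',h')$ adjacent iff either $gg'\in E(G)$, or $g=g'$ and $hh'\in E(H)$. -}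

module Defs where

open import Data.Nat using (ℕ; zero; suc; _≤_; _<_; pred)
open import Data.Fin using (Fin; remQuot; _≟_)
open import Data.Fin.Properties using ()
open import Data.Bool using (Bool; true; false; _∧_; _∨_)
open import Data.List using (List; []; _∷_; drop; length; filterᵇ; allFin)
open import Data.List.Relation.Unary.All using (All)
open import Data.List.Relation.Unary.Unique.Propositional using (Unique)
open import Data.Product using (Σ; ∃; ∃-syntax; _×_; _,_; proj₁; proj₂)
open import Relation.Binary.PropositionalEquality using (_≡_; _≢_)
open import Relation.Nullary using (¬_; does)

record Graph (n : ℕ) : Set where
  constructor mkGraph
  field
    adj : Fin n → Fin n → Bool
open Graph public

record IsSimple {n : ℕ} (G : Graph n) : Set where
  field
    sym   : ∀ u v → adj G u v ≡ adj G v u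
    irrefl : ∀ u → adj G u u ≡ false

data Walk {n : ℕ} (G : Graph n) : Fin n → Fin n → ℕ → Set where
  nil  : ∀ {u} → Walk G u u zero
  cons : ∀ {u w v k} → adj G u w ≡ true → Walk G w v k → Walk G u v (suc k)

module _ {n : ℕ} {G : Graph n} where
  verts : ∀ {u v k} → Walk G u v k → List (Fin n)
  verts {u} nil = u ∷ []
  verts {u} (cons _ p) = u ∷ verts p

  initVerts : ∀ {u v k} → Walk G u v k → List (Fin n)
  initVerts nil = []
  initVerts {u} (cons _ p) = u ∷ initVerts p

  inner : ∀ {u v k} → Walk G u v k → List (Fin n)
  inner p = drop 1 (initVerts p)

  IsPath : ∀ {u v k} → Walk G u v k → Set
  IsPath p = Unique (verts p)

  IsGeodesic : ∀ {u v k} → Walk G u v k → Set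
  IsGeodesic {u} {v} {k} p =
    IsPath p × (∀ k' (q : Walk G u v k') → IsPath q → k ≤ k')

IsDMV2 : ∀ {n} → Graph n → (Fin n → Bool) → Set
IsDMV2 {n} G M =
  ∀ u v → M u ≡ true → M v ≡ true → u ≢ v →
  ∃[ k ] (k ≤ 2 × Σ (Walk G u v k) λ p →
            IsGeodesic p × All (λ w → M w ≡ false) (inner p))

-- a partition of V into (at most) k 2-distance mutual-visibility sets,
-- given as the colour classes of a map into Fin k
HasDMV2Partition : ∀ {n} → Graph n → ℕ → Set
HasDMV2Partition {n} G k =
  Σ (Fin n → Fin k) λ c → ∀ (i : Fin k) → IsDMV2 G (λ v → does (c v ≟ i))

ChiMu2 : ∀ {n} → Graph n → ℕ → Set
ChiMu2 G k = HasDMV2Partition G k × (∀ j → j < k → ¬ HasDMV2Partition G j)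

deg : ∀ {n} → Graph n → Fin n → ℕ
deg {n} G v = length (filterᵇ (adj G v) (allFin n))

MinDegGe : ∀ {n} → Graph n → ℕ → Set
MinDegGe G d = ∀ v → d ≤ deg G v

MinDegEq : ∀ {n} → Graph n → ℕ → Set
MinDegEq G d = MinDegGe G d × ∃[ v ] deg G v ≡ d

-- a cycle of length k (k ≥ 3): a path v0 … v_{k-1} plus the edge v_{k-1} v0
HasCycle : ∀ {n} → Graph n → ℕ → Set
HasCycle G k = 3 ≤ k × ∃[ u ] ∃[ v ] Σ (Walk G u v (pred k)) λ p →
                 IsPath p × adj G v u ≡ true

Girth : ∀ {n} → Graph n → ℕ → Set
Girth G k = HasCycle G k × (∀ j → j < k → ¬ HasCycle G j)

Connected : ∀ {n} → Graph n → Set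
Connected G = ∀ u v → ∃[ k ] Walk G u v k

IsTree : ∀ {n} → Graph n → Set
IsTree G = Connected G × (∀ k → ¬ HasCycle G k)

-- lexicographic product on Fin (m * n) ≅ Fin m × Fin n (via remQuot)
lex : ∀ {m n} → Graph m → Graph n → Graph (m Data.Nat.* n)
lex {m} {n} G H = mkGraph λ i j →
  let g = proj₁ (remQuot {m} n i) ; h = proj₂ (remQuot {m} n i)
      g' = proj₁ (remQuot {m} n j) ; h' = proj₂ (remQuot {m} n j)
  in adj G g g' ∨ (does (g ≟ g') ∧ adj H h h')

{-# OPTIONS --safe #-}
module Submission where

-- All three examples take H = K̄₂, two independent vertices, so that every vertex of G ∘ H
-- has a non-adjacent twin. Two vertices of one 2-distance mutual-visibility class are at
-- distance at most 2, and a vertex u of a class that also contains a non-adjacent vertex v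
-- must see v through a common neighbour outside the class. Hence the region {u, v} ∪ N(u)
-- around a non-adjacent pair meets two classes, and regions at distance more than 2 meet
-- disjoint sets of classes. In K₃ ∘ K̄₂ and K₂ ∘ K̄₂ this gives two classes, while K₃ and K₂
-- need only one. In G ∘ K̄₂, with G two 4-cycles joined by an edge, two separated regions
-- give four classes, while in G the separated regions {1} and {2, 3} ∪ N(2) give only three,
-- and three suffice. The upper bounds are explicit partitions, checked by exhaustive search.

open import Defs
open import Data.Nat using (ℕ; zero; suc; _*_; _≤_; _<_; _≤?_; _≡ᵇ_; z≤n; s≤s; s≤s⁻¹)
open import Data.Nat.Properties using (≮⇒≥; <⇒≱; ≤-trans; ≤-refl; ≤-antisym)
open import Data.Fin using (Fin; zero; suc; toℕ; #_; remQuot; _≟_)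
open import Data.Fin.Properties using (pigeonhole; <⇒≢; all?; any?)
open import Data.Bool using (Bool; true; false; _∧_; _∨_; not)
open import Data.Bool.Properties using (∧-zeroʳ) renaming (_≟_ to _≟ᵇ_)
open import Data.Bool.ListAction using (any)
open import Data.List using (List; []; _∷_; length; lookup)
open import Data.List.Membership.Propositional.Properties using (∈-lookup)
open import Data.List.Relation.Unary.All as All using ([]; _∷_)
open import Data.List.Relation.Unary.AllPairs using ([]; _∷_)
open import Data.List.Relation.Unary.Unique.Propositional using (Unique)
open import Data.List.Relation.Unary.Unique.DecPropositional using (unique?)
open import Data.Product using (Σ; ∃-syntax; _×_; _,_; proj₁; proj₂)
open import Data.Sum using (_⊎_; inj₁; inj₂)
open import Function.Bundles using (mk⇔)
open import Relation.Binary.PropositionalEquality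
  using (_≡_; _≢_; refl; sym; trans; cong; cong₂; subst; module ≡-Reasoning)
open import Relation.Nullary using (¬_; Dec; does; yes; no; ¬?; contradiction)
open import Relation.Nullary.Decidable
  using (_×-dec_; _⊎-dec_; _→-dec_; map′; from-yes; dec-true; dec-false; does-⇔)
open import Level using (0ℓ)
open import Relation.Unary using (Pred; Decidable)

private
  variable
    A : Set
    n k : ℕ

does-false⇒¬ : (a? : Dec A) → does a? ≡ false → ¬ A
does-false⇒¬ (no ¬a) _ = ¬a

lookup-injective : ∀ {xs : List A} → Unique xs → ∀ i j → lookup xs i ≡ lookup xs j → i ≡ j
lookup-injective (_ ∷ _) zero zero _ = refl
lookup-injective (x∉ ∷ _) zero (suc j) eq = contradiction eq (All.lookup x∉ (∈-lookup j))
lookup-injective (x∉ ∷ _) (suc i) zero eq = contradiction (sym eq) (All.lookup x∉ (∈-lookup i))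
lookup-injective (_ ∷ u) (suc i) (suc j) eq = cong suc (lookup-injective u i j eq)

unique⇒length≤ : ∀ {xs : List (Fin n)} → Unique xs → length xs ≤ n
unique⇒length≤ {xs = xs} u = ≮⇒≥ λ n<len →
  let i , j , i<j , eq = pigeonhole n<len (lookup xs) in <⇒≢ i<j (lookup-injective u i j eq)

module _ {G : Graph n} where

  walk₀⇒≡ : ∀ {u v} → Walk G u v 0 → u ≡ v
  walk₀⇒≡ nil = refl

  walk₁⇒adj : ∀ {u v} → Walk G u v 1 → adj G u v ≡ true
  walk₁⇒adj (cons e nil) = e

  length-verts : ∀ {u v k} (p : Walk G u v k) → length (verts p) ≡ suc k
  length-verts nil = refl
  length-verts (cons _ p) = cong suc (length-verts p)

  path⇒length<n : ∀ {u v k} (p : Walk G u v k) → IsPath p → k < n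
  path⇒length<n p isPath = subst (_≤ n) (length-verts p) (unique⇒length≤ isPath)

  fewVertices⇒acyclic : n < 3 → ∀ k → ¬ HasCycle G k
  fewVertices⇒acyclic n<3 _ (s≤s (s≤s (s≤s _)) , _ , _ , p , isPath , _) =
    <⇒≱ n<3 (≤-trans (s≤s (s≤s (s≤s z≤n))) (path⇒length<n p isPath))

  cycle-intro : ∀ {u v k} → 2 ≤ k → (p : Walk G u v k) → IsPath p → adj G v u ≡ true →
    HasCycle G (suc k)
  cycle-intro 2≤k p isPath vu = s≤s 2≤k , _ , _ , p , isPath , vu

  TriangleFree : Set
  TriangleFree = ∀ u w v → ¬ (adj G u w ≡ true × adj G w v ≡ true × adj G v u ≡ true)

  triangleFree⇒¬cycle₃ : TriangleFree → ¬ HasCycle G 3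
  triangleFree⇒¬cycle₃ noTriangle (_ , u , v , cons {w = w} uw (cons wv nil) , _ , vu) =
    noTriangle u w v (uw , wv , vu)

  girth₃ : HasCycle G 3 → Girth G 3
  girth₃ triangle = triangle , λ j j<3 (3≤j , _) → <⇒≱ j<3 3≤j

  girth₄ : HasCycle G 4 → TriangleFree → Girth G 4
  girth₄ square noTriangle = square , shorter
    where
    shorter : ∀ j → j < 4 → ¬ HasCycle G j
    shorter j j<4 cycle@(3≤j , _) with ≤-antisym 3≤j (s≤s⁻¹ j<4)
    ... | refl = triangleFree⇒¬cycle₃ noTriangle cycle

  adj⇒≢ : IsSimple G → ∀ {u v} → adj G u v ≡ true → u ≢ v
  adj⇒≢ simple {u} uv refl = contradiction (trans (sym uv) (IsSimple.irrefl simple u)) λ ()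

  edge-isGeodesic : ∀ {u v} → u ≢ v → (uv : adj G u v ≡ true) → IsGeodesic (cons uv nil)
  edge-isGeodesic u≢v uv = ((u≢v ∷ []) ∷ [] ∷ []) , shortest
    where
    shortest : ∀ k (q : Walk G _ _ k) → IsPath q → 1 ≤ k
    shortest zero q _ = contradiction (walk₀⇒≡ q) u≢v
    shortest (suc _) _ _ = s≤s z≤n

  twoPath-isGeodesic : IsSimple G → ∀ {u w v} → u ≢ v → adj G u v ≡ false →
    (uw : adj G u w ≡ true) (wv : adj G w v ≡ true) → IsGeodesic (cons uw (cons wv nil))
  twoPath-isGeodesic simple u≢v ¬uv uw wv =
    ((adj⇒≢ simple uw ∷ u≢v ∷ []) ∷ (adj⇒≢ simple wv ∷ []) ∷ [] ∷ []) , shortest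
    where
    shortest : ∀ k (q : Walk G _ _ k) → IsPath q → 2 ≤ k
    shortest zero q _ = contradiction (walk₀⇒≡ q) u≢v
    shortest (suc zero) q _ = contradiction (trans (sym (walk₁⇒adj q)) ¬uv) λ ()
    shortest (suc (suc _)) _ _ = s≤s (s≤s z≤n)

lex-isSimple : ∀ {m} {G : Graph m} {H : Graph n} → IsSimple G → IsSimple H → IsSimple (lex G H)
lex-isSimple {n} {m} {G} {H} simpleG simpleH = record
  { sym = λ i j → symmetric (vertex i) (vertex j) (layer i) (layer j)
  ; irrefl = λ i → irreflexive (vertex i) (layer i)
  }
  where
  vertex : Fin (m * n) → Fin m
  vertex i = proj₁ (remQuot {m} n i)

  layer : Fin (m * n) → Fin n
  layer i = proj₂ (remQuot {m} n i)

  symmetric : ∀ g g′ h h′ →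
    adj G g g′ ∨ (does (g ≟ g′) ∧ adj H h h′) ≡ adj G g′ g ∨ (does (g′ ≟ g) ∧ adj H h′ h)
  symmetric g g′ h h′ = cong₂ _∨_ (IsSimple.sym simpleG g g′)
    (cong₂ _∧_ (does-⇔ (mk⇔ sym sym) (g ≟ g′) (g′ ≟ g)) (IsSimple.sym simpleH h h′))

  irreflexive : ∀ g h → adj G g g ∨ (does (g ≟ g) ∧ adj H h h) ≡ false
  irreflexive g h = begin
    adj G g g ∨ (does (g ≟ g) ∧ adj H h h)
      ≡⟨ cong₂ (λ a b → a ∨ (does (g ≟ g) ∧ b)) (IsSimple.irrefl simpleG g) (IsSimple.irrefl simpleH h) ⟩
    does (g ≟ g) ∧ false
      ≡⟨ ∧-zeroʳ _ ⟩
    false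
      ∎
    where open ≡-Reasoning

edgeless : (n : ℕ) → Graph n
edgeless n = mkGraph λ _ _ → false

edgeless-isSimple : IsSimple (edgeless n)
edgeless-isSimple = record { sym = λ _ _ → refl ; irrefl = λ _ → refl }

complete : (n : ℕ) → Graph n
complete n = mkGraph λ u v → not (does (u ≟ v))

module _ {n : ℕ} where

  complete-adj : ∀ {u v : Fin n} → u ≢ v → adj (complete n) u v ≡ true
  complete-adj {u} {v} u≢v = cong not (dec-false (u ≟ v) u≢v)

  complete-isSimple : IsSimple (complete n)
  complete-isSimple = record
    { sym = λ u v → cong not (does-⇔ (mk⇔ sym sym) (u ≟ v) (v ≟ u))
    ; irrefl = λ u → cong not (dec-true (u ≟ u) refl)
    }

  complete-connected : Connected (complete n)
  complete-connected u v with u ≟ v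
  ... | yes refl = 0 , nil
  ... | no u≢v = 1 , cons (complete-adj u≢v) nil

fromEdges : (n : ℕ) → List (ℕ × ℕ) → Graph n
fromEdges n es = mkGraph λ u v →
  any (λ (a , b) → ((toℕ u ≡ᵇ a) ∧ (toℕ v ≡ᵇ b)) ∨ ((toℕ u ≡ᵇ b) ∧ (toℕ v ≡ᵇ a))) es

Visible : Graph n → (Fin n → Bool) → Fin n → Fin n → Set
Visible G M u v = adj G u v ≡ true ⊎ ∃[ w ] (adj G u w ≡ true × adj G w v ≡ true × M w ≡ false)

MutuallyVisible : Graph n → (Fin n → Bool) → Set
MutuallyVisible G M = ∀ u v → M u ≡ true → M v ≡ true → u ≢ v → Visible G M u v

module _ {G : Graph n} {M : Fin n → Bool} where

  mutuallyVisible⇒dmv2 : IsSimple G → MutuallyVisible G M → IsDMV2 G M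
  mutuallyVisible⇒dmv2 simple visible u v Mu Mv u≢v with adj G u v in uv | visible u v Mu Mv u≢v
  ... | true  | _ = 1 , s≤s z≤n , cons uv nil , edge-isGeodesic u≢v uv , []
  ... | false | inj₁ ()
  ... | false | inj₂ (w , uw , wv , Mw) =
    2 , ≤-refl , cons uw (cons wv nil) , twoPath-isGeodesic simple u≢v uv uw wv , Mw ∷ []

  dmv2⇒mutuallyVisible : IsDMV2 G M → MutuallyVisible G M
  dmv2⇒mutuallyVisible dmv2 u v Mu Mv u≢v with dmv2 u v Mu Mv u≢v
  ... | _ , _ , nil , _ = contradiction refl u≢v
  ... | _ , _ , cons uv nil , _ = inj₁ uv
  ... | _ , _ , cons uw (cons wv nil) , _ , Mw ∷ [] = inj₂ (_ , uw , wv , Mw)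
  ... | _ , s≤s (s≤s ()) , cons _ (cons _ (cons _ _)) , _

colourClass : (Fin n → Fin k) → Fin k → Fin n → Bool
colourClass c i v = does (c v ≟ i)

partition-intro : ∀ {G : Graph n} → IsSimple G → (c : Fin n → Fin k) →
  (∀ i → MutuallyVisible G (colourClass c i)) → HasDMV2Partition G k
partition-intro simple c visible = c , λ i → mutuallyVisible⇒dmv2 simple (visible i)

chiMu2-intro : ∀ {G : Graph n} → HasDMV2Partition G k →
  (∀ {j} → HasDMV2Partition G j → k ≤ j) → ChiMu2 G k
chiMu2-intro partition lowerBound =
  partition , λ j j<k partitionⱼ → <⇒≱ j<k (lowerBound partitionⱼ)

Near : Graph n → Fin n → Fin n → Set
Near G u v = u ≡ v ⊎ adj G u v ≡ true ⊎ ∃[ w ] (adj G u w ≡ true × adj G w v ≡ true)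

Separated : Graph n → Pred (Fin n) 0ℓ → Pred (Fin n) 0ℓ → Set
Separated G X Y = ∀ w w′ → X w → Y w′ → ¬ Near G w w′

Around : Graph n → Fin n → Fin n → Pred (Fin n) 0ℓ
Around G u v w = w ≡ u ⊎ w ≡ v ⊎ adj G u w ≡ true

module _ {G : Graph n} (c : Fin n → Fin k) (isPartition : ∀ i → IsDMV2 G (colourClass c i)) where

  private
    sameColour⇒visible : ∀ {u v} → c u ≡ c v → u ≢ v → Visible G (colourClass c (c u)) u v
    sameColour⇒visible {u} {v} cu≡cv = dmv2⇒mutuallyVisible (isPartition (c u)) u v
      (dec-true (c u ≟ c u) refl) (dec-true (c v ≟ c u) (sym cu≡cv))

  sameColour⇒near : ∀ {u v} → c u ≡ c v → Near G u v
  sameColour⇒near {u} {v} cu≡cv with u ≟ v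
  ... | yes u≡v = inj₁ u≡v
  ... | no u≢v with sameColour⇒visible cu≡cv u≢v
  ...   | inj₁ uv = inj₂ (inj₁ uv)
  ...   | inj₂ (w , uw , wv , _) = inj₂ (inj₂ (w , uw , wv))

  separated⇒differentColours : ∀ {X Y} → Separated G X Y → ∀ w w′ → X w → Y w′ → c w ≢ c w′
  separated⇒differentColours separated w w′ w∈X w′∈Y cw≡cw′ =
    separated w w′ w∈X w′∈Y (sameColour⇒near cw≡cw′)

  -- Either v itself, or the common neighbour through which u sees v, leaves the colour of u.
  nonadjacent⇒otherColour : ∀ {u v} → adj G u v ≡ false → u ≢ v →
    ∃[ w ] (Around G u v w × c u ≢ c w)
  nonadjacent⇒otherColour {u} {v} ¬uv u≢v with c u ≟ c v
  ... | no cu≢cv = v , inj₂ (inj₁ refl) , cu≢cv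
  ... | yes cu≡cv with sameColour⇒visible cu≡cv u≢v
  ...   | inj₁ uv = contradiction (trans (sym uv) ¬uv) λ ()
  ...   | inj₂ (w , uw , _ , Mw) =
    w , inj₂ (inj₂ uw) , λ cu≡cw → does-false⇒¬ (c w ≟ c u) Mw (sym cu≡cw)

module _ {G : Graph n} {j : ℕ} where

  nonempty⇒1≤ : Fin n → HasDMV2Partition G j → 1 ≤ j
  nonempty⇒1≤ u (c , _) = unique⇒length≤ {xs = c u ∷ []} ([] ∷ [])

  nonadjacent⇒2≤ : ∀ {u v} → adj G u v ≡ false → u ≢ v → HasDMV2Partition G j → 2 ≤ j
  nonadjacent⇒2≤ {u} ¬uv u≢v (c , isPartition) =
    let w , _ , cu≢cw = nonadjacent⇒otherColour c isPartition ¬uv u≢v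
    in unique⇒length≤ {xs = c u ∷ c w ∷ []} ((cu≢cw ∷ []) ∷ [] ∷ [])

  separatedFromNonadjacent⇒3≤ : ∀ {x u v} → adj G u v ≡ false → u ≢ v →
    Separated G (_≡ x) (Around G u v) → HasDMV2Partition G j → 3 ≤ j
  separatedFromNonadjacent⇒3≤ {x} {u} ¬uv u≢v separated (c , isPartition) =
    let w , w∈ , cu≢cw = nonadjacent⇒otherColour c isPartition ¬uv u≢v
        far = separated⇒differentColours c isPartition separated x
    in unique⇒length≤ {xs = c x ∷ c u ∷ c w ∷ []}
         ((far u refl (inj₁ refl) ∷ far w refl w∈ ∷ []) ∷ (cu≢cw ∷ []) ∷ [] ∷ [])

  separatedNonadjacent⇒4≤ : ∀ {u v u′ v′} → adj G u v ≡ false → u ≢ v → adj G u′ v′ ≡ false → u′ ≢ v′ →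
    Separated G (Around G u v) (Around G u′ v′) → HasDMV2Partition G j → 4 ≤ j
  separatedNonadjacent⇒4≤ {u = u} {u′ = u′} ¬uv u≢v ¬u′v′ u′≢v′ separated (c , isPartition) =
    let w , w∈ , cu≢cw = nonadjacent⇒otherColour c isPartition ¬uv u≢v
        w′ , w′∈ , cu′≢cw′ = nonadjacent⇒otherColour c isPartition ¬u′v′ u′≢v′
        far = separated⇒differentColours c isPartition separated
    in unique⇒length≤ {xs = c u ∷ c w ∷ c u′ ∷ c w′ ∷ []}
         ( (cu≢cw ∷ far u u′ (inj₁ refl) (inj₁ refl) ∷ far u w′ (inj₁ refl) w′∈ ∷ [])
         ∷ (far w u′ w∈ (inj₁ refl) ∷ far w w′ w∈ w′∈ ∷ [])
         ∷ (cu′≢cw′ ∷ [])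
         ∷ [] ∷ [])

complete-chiMu2 : ChiMu2 (complete (suc n)) 1
complete-chiMu2 = chiMu2-intro (partition-intro complete-isSimple (λ _ → zero) adjacent) (nonempty⇒1≤ zero)
  where
  adjacent : ∀ i → MutuallyVisible (complete _) (colourClass (λ _ → zero) i)
  adjacent _ _ _ _ _ u≢v = inj₁ (complete-adj u≢v)

isSimple? : (G : Graph n) → Dec (IsSimple G)
isSimple? G = map′ (λ (s , i) → record { sym = s ; irrefl = i }) (λ s → IsSimple.sym s , IsSimple.irrefl s)
  ((all? λ u → all? λ v → adj G u v ≟ᵇ adj G v u) ×-dec (all? λ u → adj G u u ≟ᵇ false))

minDegGe? : (G : Graph n) (d : ℕ) → Dec (MinDegGe G d)
minDegGe? G d = all? λ v → d ≤? deg G v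

triangleFree? : (G : Graph n) → Dec (TriangleFree {G = G})
triangleFree? G = all? λ u → all? λ w → all? λ v →
  ¬? (adj G u w ≟ᵇ true ×-dec adj G w v ≟ᵇ true ×-dec adj G v u ≟ᵇ true)

visible? : (G : Graph n) (M : Fin n → Bool) → ∀ u v → Dec (Visible G M u v)
visible? G M u v = adj G u v ≟ᵇ true
  ⊎-dec any? λ w → adj G u w ≟ᵇ true ×-dec adj G w v ≟ᵇ true ×-dec M w ≟ᵇ false

isDMV2Colouring? : (G : Graph n) (c : Fin n → Fin k) →
  Dec (∀ i → MutuallyVisible G (colourClass c i))
isDMV2Colouring? G c = all? λ i → all? λ u → all? λ v →
  colourClass c i u ≟ᵇ true →-dec colourClass c i v ≟ᵇ true →-dec ¬? (u ≟ v) →-dec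
  visible? G (colourClass c i) u v

near? : (G : Graph n) → ∀ u v → Dec (Near G u v)
near? G u v = u ≟ v ⊎-dec adj G u v ≟ᵇ true ⊎-dec any? λ w → adj G u w ≟ᵇ true ×-dec adj G w v ≟ᵇ true

around? : (G : Graph n) → ∀ u v → Decidable (Around G u v)
around? G u v w = w ≟ u ⊎-dec w ≟ v ⊎-dec adj G u w ≟ᵇ true

separated? : (G : Graph n) {X Y : Pred (Fin n) 0ℓ} → Decidable X → Decidable Y → Dec (Separated G X Y)
separated? G X? Y? = all? λ w → all? λ w′ → X? w →-dec Y? w′ →-dec ¬? (near? G w w′)

K̄₂ : Graph 2
K̄₂ = edgeless 2

K̄₂-isSimple : IsSimple K̄₂
K̄₂-isSimple = edgeless-isSimple

twoSquares : Graph 8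
twoSquares = fromEdges 8
  ((0 , 4) ∷ (4 , 1) ∷ (1 , 5) ∷ (5 , 0) ∷ (2 , 6) ∷ (6 , 3) ∷ (3 , 7) ∷ (7 , 2) ∷ (0 , 6) ∷ [])

twoSquares-isSimple : IsSimple twoSquares
twoSquares-isSimple = from-yes (isSimple? twoSquares)

twoSquares-girth : Girth twoSquares 4
twoSquares-girth =
  girth₄ (cycle-intro (s≤s (s≤s z≤n)) square (from-yes (unique? _≟_ (verts square))) refl)
         (from-yes (triangleFree? twoSquares))
  where
  square : Walk twoSquares (# 0) (# 5) 3
  square = cons {w = # 4} refl (cons {w = # 1} refl (cons refl nil))

twoSquares-chiMu2 : ChiMu2 twoSquares 3
twoSquares-chiMu2 = chiMu2-intro
  (partition-intro twoSquares-isSimple colouring (from-yes (isDMV2Colouring? twoSquares colouring)))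
  (separatedFromNonadjacent⇒3≤ refl (λ ())
    (from-yes (separated? twoSquares (_≟ # 1) (around? twoSquares (# 2) (# 3)))))
  where
  colouring : Fin 8 → Fin 3
  colouring = lookup (# 0 ∷ # 0 ∷ # 1 ∷ # 1 ∷ # 0 ∷ # 2 ∷ # 2 ∷ # 1 ∷ [])

-- The vertex (g , h) of lex G K̄₂ is numbered 2g + h.
twoSquares∘K̄₂-chiMu2 : ChiMu2 (lex twoSquares K̄₂) 4
twoSquares∘K̄₂-chiMu2 = chiMu2-intro
  (partition-intro (lex-isSimple twoSquares-isSimple K̄₂-isSimple) colouring
    (from-yes (isDMV2Colouring? (lex twoSquares K̄₂) colouring)))
  (separatedNonadjacent⇒4≤ refl (λ ()) refl (λ ())
    (from-yes (separated? (lex twoSquares K̄₂)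
      (around? (lex twoSquares K̄₂) (# 2) (# 3)) (around? (lex twoSquares K̄₂) (# 14) (# 15)))))
  where
  colouring : Fin 16 → Fin 4
  colouring = lookup (# 0 ∷ # 0 ∷ # 0 ∷ # 0 ∷ # 1 ∷ # 1 ∷ # 1 ∷ # 1 ∷
                      # 0 ∷ # 2 ∷ # 2 ∷ # 2 ∷ # 1 ∷ # 1 ∷ # 3 ∷ # 3 ∷ [])

K₃-girth : Girth (complete 3) 3
K₃-girth = girth₃ (cycle-intro (s≤s (s≤s z≤n)) triangle (from-yes (unique? _≟_ (verts triangle))) refl)
  where
  triangle : Walk (complete 3) (# 0) (# 2) 2
  triangle = cons {w = # 1} refl (cons refl nil)

K₃∘K̄₂-chiMu2 : ChiMu2 (lex (complete 3) K̄₂) 2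
K₃∘K̄₂-chiMu2 = chiMu2-intro
  (partition-intro (lex-isSimple (complete-isSimple {3}) K̄₂-isSimple) colouring
    (from-yes (isDMV2Colouring? (lex (complete 3) K̄₂) colouring)))
  (nonadjacent⇒2≤ {u = # 0} {v = # 1} refl (λ ()))
  where
  colouring : Fin 6 → Fin 2
  colouring = lookup (# 0 ∷ # 0 ∷ # 0 ∷ # 0 ∷ # 0 ∷ # 1 ∷ [])

K₂-isTree : IsTree (complete 2)
K₂-isTree = complete-connected , fewVertices⇒acyclic ≤-refl

K₂∘K̄₂-chiMu2 : ChiMu2 (lex (complete 2) K̄₂) 2
K₂∘K̄₂-chiMu2 = chiMu2-intro
  (partition-intro (lex-isSimple (complete-isSimple {2}) K̄₂-isSimple) colouring
    (from-yes (isDMV2Colouring? (lex (complete 2) K̄₂) colouring)))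
  (nonadjacent⇒2≤ {u = # 0} {v = # 1} refl (λ ()))
  where
  colouring : Fin 4 → Fin 2
  colouring = lookup (# 0 ∷ # 0 ∷ # 0 ∷ # 1 ∷ [])

proposition4p3 :
    (∃[ m ] Σ (Graph m) λ G → ∃[ n ] Σ (Graph n) λ H →
       IsSimple G × IsSimple H × MinDegGe G 2 × Girth G 4 ×
       ∃[ a ] ∃[ b ] (ChiMu2 (lex G H) a × ChiMu2 G b × b < a))
    × (∃[ m ] Σ (Graph m) λ G → ∃[ n ] Σ (Graph n) λ H →
       IsSimple G × IsSimple H × MinDegGe G 2 × Girth G 3 ×
       ∃[ a ] ∃[ b ] (ChiMu2 (lex G H) a × ChiMu2 G b × b < a))
    × (∃[ m ] Σ (Graph m) λ T → ∃[ n ] Σ (Graph n) λ H →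
       IsSimple T × IsSimple H × IsTree T × MinDegEq T 1 ×
       ∃[ a ] ∃[ b ] (ChiMu2 (lex T H) a × ChiMu2 T b × b < a))
proposition4p3 =
    ( 8 , twoSquares , 2 , K̄₂ , twoSquares-isSimple , K̄₂-isSimple
    , from-yes (minDegGe? twoSquares 2) , twoSquares-girth
    , 4 , 3 , twoSquares∘K̄₂-chiMu2 , twoSquares-chiMu2 , ≤-refl )
  , ( 3 , complete 3 , 2 , K̄₂ , complete-isSimple , K̄₂-isSimple
    , from-yes (minDegGe? (complete 3) 2) , K₃-girth
    , 2 , 1 , K₃∘K̄₂-chiMu2 , complete-chiMu2 , ≤-refl )
  , ( 2 , complete 2 , 2 , K̄₂ , complete-isSimple , K̄₂-isSimple
    , K₂-isTree , (from-yes (minDegGe? (complete 2) 1) , # 0 , refl)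
    , 2 , 1 , K₂∘K̄₂-chiMu2 , complete-chiMu2 , ≤-refl )
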